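{- Let $p\geq 3$ be odd, let $G=(V,E)$ be a $(p,2)$-flex-connected graph, and suppose a violated set $A\subseteq V$ amenably crosses a violated set $B\subseteq V$. Then for every violated set $C\subseteq V$, either $A$ does not cross $C$ or $A$ amenably crosses $C$.
   Context: $G=(V,E)$ is a finite graph (parallel edges allowed) whose edge set is partitioned into safe and unsafe edges; $\mathcal{U}$ is the set of unsafe edges. For $S\subseteq V$, $\delta(S)$ is the set of edges with exactly one endpoint in $S$; for disjoint $X,Y\subseteq V$, $E(X,Y)$ is the set of edges with one endpoint in $X$ and the other in $Y$. $G$ is $(p,2)$-flex-connected if for every $F\subseteq\mathcal{U}$ with $|F|\leq 2$ the graph $(V,E\setminus F)$ is $p$-edge-connected. A set $S\subseteq V$ is violated if $|\delta(S)|=p+2$ and $\delta(S)$ contains at least $3$ unsafe edges. Two sets $A,B\subseteq V$ cross if $A\setminus B$, $A\cap B$, $B\setminus A$, $V\setminus(A\cup B)$ are all nonempty. $A$ amenably crosses $B$ if $A$ crosses $B$ and at least one of the edge sets $E(A\cap B, B\setminus A)$ and $E(A\setminus B, V\setminus(A\cup B))$ contains no unsafe edge. -}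

module Defs where

open import Data.Nat using (ℕ; zero; suc; _+_; _*_; _≤_)
open import Data.Bool using (Bool; true; false; not; _∧_; _∨_; _xor_; if_then_else_)
open import Data.Fin using (Fin)
open import Data.Product using (_×_; _,_; proj₁; proj₂; ∃-syntax)
open import Relation.Binary.PropositionalEquality using (_≡_)
open import Relation.Nullary using (¬_)
open import Data.Sum using (_⊎_)

-- A finite multigraph: n vertices (Fin n), m edges (Fin m), each edge has two
-- endpoints (parallel edges allowed); the edge set is partitioned into safe
-- and unsafe edges by the Boolean flag `unsafe`.
record Graph : Set where
  field
    n      : ℕ
    m      : ℕ
    ends   : Fin m → Fin n × Fin n
    unsafe : Fin m → Bool
open Graph public

VSet : Graph → Set
VSet G = Fin (n G) → Bool

ESet : Graph → Set
ESet G = Fin (m G) → Bool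

count : ∀ {k} → (Fin k → Bool) → ℕ
count {zero}  f = 0
count {suc k} f = (if f Fin.zero then 1 else 0) + count (λ i → f (Fin.suc i))

δ : (G : Graph) → VSet G → ESet G
δ G S e = S (proj₁ (ends G e)) xor S (proj₂ (ends G e))

Ebetween : (G : Graph) → VSet G → VSet G → ESet G
Ebetween G X Y e =
  (X (proj₁ (ends G e)) ∧ Y (proj₂ (ends G e))) ∨
  (Y (proj₁ (ends G e)) ∧ X (proj₂ (ends G e)))

Nonempty : ∀ {k} → (Fin k → Bool) → Set
Nonempty S = ∃[ v ] S v ≡ true

EdgeConnectedWithout : (G : Graph) → ℕ → ESet G → Set
EdgeConnectedWithout G p F =
  (S : VSet G) → Nonempty S → Nonempty (λ v → not (S v)) →
  p ≤ count (λ e → δ G S e ∧ not (F e))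

FlexConnected : (G : Graph) → ℕ → Set
FlexConnected G p =
  (F : ESet G) → (∀ e → F e ≡ true → unsafe G e ≡ true) → count F ≤ 2 →
  EdgeConnectedWithout G p F

Violated : (G : Graph) → ℕ → VSet G → Set
Violated G p S =
  count (δ G S) ≡ p + 2 × 3 ≤ count (λ e → δ G S e ∧ unsafe G e)

_∩_ : ∀ {k} → (Fin k → Bool) → (Fin k → Bool) → Fin k → Bool
(A ∩ B) v = A v ∧ B v

_∖_ : ∀ {k} → (Fin k → Bool) → (Fin k → Bool) → Fin k → Bool
(A ∖ B) v = A v ∧ not (B v)

_∪_ : ∀ {k} → (Fin k → Bool) → (Fin k → Bool) → Fin k → Bool
(A ∪ B) v = A v ∨ B v

compl : ∀ {k} → (Fin k → Bool) → Fin k → Bool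
compl A v = not (A v)

Cross : (G : Graph) → VSet G → VSet G → Set
Cross G A B =
  Nonempty (A ∖ B) × Nonempty (A ∩ B) × Nonempty (B ∖ A) ×
  Nonempty (compl (A ∪ B))

NoUnsafeEdge : (G : Graph) → ESet G → Set
NoUnsafeEdge G F = ∀ e → F e ≡ true → unsafe G e ≡ false

AmenablyCross : (G : Graph) → VSet G → VSet G → Set
AmenablyCross G A B =
  Cross G A B ×
  (NoUnsafeEdge G (Ebetween G (A ∩ B) (B ∖ A)) ⊎
   NoUnsafeEdge G (Ebetween G (A ∖ B) (compl (A ∪ B))))

Odd : ℕ → Set
Odd p = ∃[ k ] p ≡ suc (2 * k)

-- Write d(X) for |δ(X)| and u(X) for the number of unsafe edges in δ(X). Deleting up to two unsafe
-- edges of δ(X) must leave p edges, so d(X) ≥ p + min(2, u(X)) for every proper nonempty X, while a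
-- violated set has d = p + 2 and u ≥ 3.
--
-- For crossing violated sets S and T, comparing the degrees of the four quadrants with d(S) + d(T),
-- and using that p is odd, shows that no edge joins S ∩ T to V ∖ (S ∪ T), nor S ∖ T to T ∖ S.
--
-- Now let E(A ∩ B, B ∖ A) have no unsafe edge (the other amenable case is this one for V ∖ B) and let
-- both E(A ∩ C, C ∖ A) and E(A ∖ C, V ∖ (A ∪ C)) contain unsafe edges. As the diagonals are empty,
-- every unsafe edge of δ(A) joins two atoms of the partition by A, B, C that lie outside B and differ
-- only in A. Pair bounds on the quadrants of B and of C then force edges across A also inside the two
-- cells within B, so all eight atoms are proper and nonempty. Their bounds add up to
-- 8p + 7 ≤ 2(d(A) + d(B) + d(C)) = 6p + 12, which fails for p ≥ 3.

module Submission where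

open import Defs
open import Data.Bool using (Bool; true; false; not; _∧_; _∨_; _xor_; if_then_else_; T)
open import Data.Bool.Properties using () renaming (_≟_ to _≟ᵇ_)
open import Data.Empty using (⊥; ⊥-elim)
open import Data.Unit using (⊤)
open import Data.Fin using (Fin; zero; suc)
open import Data.Fin.Properties using (any?; all?)
open import Data.List using (List; []; _∷_; map)
open import Data.Bool.ListAction using (any)
open import Data.List.Relation.Unary.All as All using (All)
open import Data.Nat using (ℕ; zero; suc; _+_; _*_; _≤_; _<_; _⊓_; z≤n; s≤s; _≤?_)
open import Data.Nat.Base using (parity)
open import Data.Nat.Properties
open import Algebra.Properties.CommutativeSemigroup +-commutativeSemigroup using (interchange)
open import Data.Nat.Tactic.RingSolver using (solve)
open import Data.Parity.Base using (0ℙ; 1ℙ)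
open import Data.Product using (_×_; _,_; proj₁; proj₂; ∃-syntax; swap)
open import Data.Sum using (_⊎_; inj₁; inj₂)
open import Function using (_∘_)
open import Relation.Nullary using (¬_; Dec; yes; no; contradiction)
open import Relation.Nullary.Decidable using (True; False; T?; toWitness; toWitnessFalse; map′; _×-dec_; _→-dec_)
open import Relation.Binary.PropositionalEquality using (_≡_; _≢_; refl; sym; trans; cong; cong₂; subst; module ≡-Reasoning)

indicator : Bool → ℕ
indicator b = if b then 1 else 0

-- Right-nested sum with no trailing 0, so that ∑ (x ∷ y ∷ []) is x + y.
∑ : List ℕ → ℕ
∑ []           = 0
∑ (x ∷ [])     = x
∑ (x ∷ y ∷ xs) = x + ∑ (y ∷ xs)

∑-mono : ∀ {X : Set} {f g : X → ℕ} (xs : List X) → All (λ x → f x ≤ g x) xs → ∑ (map f xs) ≤ ∑ (map g xs)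
∑-mono []           All.[]                        = z≤n
∑-mono (x ∷ [])     (fx≤gx All.∷ All.[])          = fx≤gx
∑-mono (x ∷ y ∷ xs) (fx≤gx All.∷ fxs≤gxs)         = +-mono-≤ fx≤gx (∑-mono (y ∷ xs) fxs≤gxs)

∑-map-0 : ∀ {X : Set} (xs : List X) → ∑ (map (λ _ → 0) xs) ≡ 0
∑-map-0 []           = refl
∑-map-0 (x ∷ [])     = refl
∑-map-0 (x ∷ y ∷ xs) = ∑-map-0 (y ∷ xs)

∑-map-+ : ∀ {X : Set} (f g : X → ℕ) xs →
  ∑ (map (λ x → f x + g x) xs) ≡ ∑ (map f xs) + ∑ (map g xs)
∑-map-+ f g []           = refl
∑-map-+ f g (x ∷ [])     = refl
∑-map-+ f g (x ∷ y ∷ xs) =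
  trans (cong (f x + g x +_) (∑-map-+ f g (y ∷ xs))) (interchange (f x) (g x) _ _)

module _ {X : Set} where

  counts : ∀ {k} → (Fin k → X) → List (X → Bool) → List ℕ
  counts f = map (λ P → count (λ i → P (f i)))

  indicators : X → List (X → Bool) → List ℕ
  indicators x = map (λ P → indicator (P x))

  ∑counts-mono : ∀ {k} (f : Fin k → X) (R : X → Set) → (∀ i → R (f i)) →
    (Ps Qs : List (X → Bool)) → (∀ x → R x → ∑ (indicators x Ps) ≤ ∑ (indicators x Qs)) →
    ∑ (counts f Ps) ≤ ∑ (counts f Qs)
  ∑counts-mono {zero} f R Rf Ps Qs _ = ≤-reflexive (trans (∑-map-0 Ps) (sym (∑-map-0 Qs)))
  ∑counts-mono {suc k} f R Rf Ps Qs h = begin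
    ∑ (counts f Ps)                                        ≡⟨ ∑-map-+ _ _ Ps ⟩
    ∑ (indicators (f zero) Ps) + ∑ (counts (f ∘ suc) Ps)   ≤⟨ +-mono-≤ (h (f zero) (Rf zero)) IH ⟩
    ∑ (indicators (f zero) Qs) + ∑ (counts (f ∘ suc) Qs)   ≡⟨ ∑-map-+ _ _ Qs ⟨
    ∑ (counts f Qs)                                        ∎
    where
    open ≤-Reasoning
    IH : ∑ (counts (f ∘ suc) Ps) ≤ ∑ (counts (f ∘ suc) Qs)
    IH = ∑counts-mono (f ∘ suc) R (Rf ∘ suc) Ps Qs h

count-const-false : ∀ {k} → count {k} (λ _ → false) ≡ 0
count-const-false {zero}  = refl
count-const-false {suc k} = count-const-false {k}

count-pos⇒∃ : ∀ {k} (f : Fin k → Bool) → 1 ≤ count f → ∃[ i ] f i ≡ true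
count-pos⇒∃ {suc k} f h with f zero in fi
... | true  = zero , fi
... | false = let (i , fi) = count-pos⇒∃ (f ∘ suc) h in suc i , fi

∃⇒count-pos : ∀ {k} (f : Fin k → Bool) i → f i ≡ true → 1 ≤ count f
∃⇒count-pos f zero    fi rewrite fi = s≤s z≤n
∃⇒count-pos f (suc i) fi = ≤-trans (∃⇒count-pos (f ∘ suc) i fi) (m≤n+m _ _)

count≡0⇒false : ∀ {k} (f : Fin k → Bool) → count f ≡ 0 → ∀ i → f i ≡ false
count≡0⇒false f c0 i with f i in fi
... | false = refl
... | true  = contradiction (≤-trans (∃⇒count-pos f i fi) (≤-reflexive c0)) λ ()

false⇒count≡0 : ∀ {k} (f : Fin k → Bool) → (∀ i → f i ≡ false) → count f ≡ 0
false⇒count≡0 {zero}  f h = refl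
false⇒count≡0 {suc k} f h rewrite h zero = false⇒count≡0 (f ∘ suc) (h ∘ suc)

count-∖ : ∀ {k} (D F : Fin k → Bool) → (∀ i → F i ≡ true → D i ≡ true) →
  count (λ i → D i ∧ not (F i)) + count F ≡ count D
count-∖ {zero}  D F F⊆D = refl
count-∖ {suc k} D F F⊆D with D zero in d0 | F zero in f0
... | true  | true  = trans (+-suc _ _) (cong suc (count-∖ (D ∘ suc) (F ∘ suc) (F⊆D ∘ suc)))
... | true  | false = cong suc (count-∖ (D ∘ suc) (F ∘ suc) (F⊆D ∘ suc))
... | false | false = count-∖ (D ∘ suc) (F ∘ suc) (F⊆D ∘ suc)
... | false | true  with () ← trans (sym d0) (F⊆D zero f0)

firsts : ∀ {k} → ℕ → (Fin k → Bool) → Fin k → Bool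
firsts zero    f i       = false
firsts (suc n) f zero    = f zero
firsts (suc n) f (suc i) = if f zero then firsts n (f ∘ suc) i else firsts (suc n) (f ∘ suc) i

firsts-⊆ : ∀ {k} n (f : Fin k → Bool) i → firsts n f i ≡ true → f i ≡ true
firsts-⊆ (suc n) f zero    h = h
firsts-⊆ (suc n) f (suc i) h with f zero
... | true  = firsts-⊆ n (f ∘ suc) i h
... | false = firsts-⊆ (suc n) (f ∘ suc) i h

count-firsts : ∀ {k} n (f : Fin k → Bool) → count (firsts n f) ≡ n ⊓ count f
count-firsts {zero}  n       f = sym (⊓-zeroʳ n)
count-firsts {suc k} zero    f = count-const-false {suc k}
count-firsts {suc k} (suc n) f with f zero
... | true  = cong suc (count-firsts n (f ∘ suc))
... | false = count-firsts (suc n) (f ∘ suc)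

-- Removing two unsafe edges of δ(S) (or all of them, if fewer) leaves at least p edges.
flex-cut-bound : ∀ {G p} → FlexConnected G p → (S : VSet G) → Nonempty S → Nonempty (compl S) →
  p + 2 ⊓ count (λ e → δ G S e ∧ unsafe G e) ≤ count (δ G S)
flex-cut-bound {G} {p} flex S S≠∅ ∁S≠∅ = begin
  p + 2 ⊓ count δᵘ                               ≡⟨ cong (p +_) (count-firsts 2 δᵘ) ⟨
  p + count F                                    ≤⟨ +-monoˡ-≤ (count F) (flex F F-unsafe ∣F∣≤2 S S≠∅ ∁S≠∅) ⟩
  count (λ e → δ G S e ∧ not (F e)) + count F    ≡⟨ count-∖ (δ G S) F (λ e → ∧-true-l ∘ firsts-⊆ 2 δᵘ e) ⟩
  count (δ G S)                                  ∎
  where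
  open ≤-Reasoning
  δᵘ F : ESet G
  δᵘ e = δ G S e ∧ unsafe G e
  F    = firsts 2 δᵘ
  ∧-true-l : ∀ {x y} → (x ∧ y) ≡ true → x ≡ true
  ∧-true-l {true} _ = refl
  ∧-true-r : ∀ {x y} → (x ∧ y) ≡ true → y ≡ true
  ∧-true-r {true} h = h
  F-unsafe : ∀ e → F e ≡ true → unsafe G e ≡ true
  F-unsafe e = ∧-true-r {δ G S e} ∘ firsts-⊆ 2 δᵘ e
  ∣F∣≤2 : count F ≤ 2
  ∣F∣≤2 = ≤-trans (≤-reflexive (count-firsts 2 δᵘ)) (m⊓n≤m 2 (count δᵘ))

-- Edge types relative to three vertex sets

∀-Bool? : {P : Bool → Set} → (∀ b → Dec (P b)) → Dec (∀ b → P b)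
∀-Bool? P? = map′ (λ (t , f) → λ { true → t ; false → f }) (λ h → h true , h false)
                  (P? true ×-dec P? false)

∀-Bool³? : {P : Bool → Bool → Bool → Set} → (∀ a b c → Dec (P a b c)) → Dec (∀ a b c → P a b c)
∀-Bool³? P? = ∀-Bool? λ a → ∀-Bool? λ b → ∀-Bool? λ c → P? a b c

-- A vertex set given by membership in three fixed sets A, B, C.
Region : Set
Region = Bool → Bool → Bool → Bool

isA isB isC : Region
isA a b c = a
isB a b c = b
isC a b c = c

_∩ʳ_ _∪ʳ_ _∖ʳ_ : Region → Region → Region
(φ ∩ʳ ψ) a b c = φ a b c ∧ ψ a b c
(φ ∪ʳ ψ) a b c = φ a b c ∨ ψ a b c
(φ ∖ʳ ψ) a b c = φ a b c ∧ not (ψ a b c)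

∁ʳ : Region → Region
∁ʳ φ a b c = not (φ a b c)

atom : Bool → Bool → Bool → Region
atom x y z a b c = not (x xor a) ∧ (not (y xor b) ∧ not (z xor c))

-- The memberships of the two ends of an edge in A, B, C, and whether the edge is unsafe.
record EdgeType : Set where
  constructor edgeType
  field
    a₁ b₁ c₁ a₂ b₂ c₂ unsafeEdge : Bool

∀-EdgeType? : {P : EdgeType → Set} → (∀ t → Dec (P t)) → Dec (∀ t → P t)
∀-EdgeType? P? =
  map′ (λ h t → let open EdgeType t in h a₁ b₁ c₁ a₂ b₂ c₂ unsafeEdge)
       (λ h a₁ b₁ c₁ a₂ b₂ c₂ u → h (edgeType a₁ b₁ c₁ a₂ b₂ c₂ u))
       (∀-Bool³? λ a₁ b₁ c₁ → ∀-Bool³? λ a₂ b₂ c₂ → ∀-Bool? λ u → P? (edgeType a₁ b₁ c₁ a₂ b₂ c₂ u))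

boundary : Region → EdgeType → Bool
boundary φ (edgeType a₁ b₁ c₁ a₂ b₂ c₂ _) = φ a₁ b₁ c₁ xor φ a₂ b₂ c₂

between : Region → Region → EdgeType → Bool
between φ ψ (edgeType a₁ b₁ c₁ a₂ b₂ c₂ _) =
  (φ a₁ b₁ c₁ ∧ ψ a₂ b₂ c₂) ∨ (ψ a₁ b₁ c₁ ∧ φ a₂ b₂ c₂)

unsafeIn : (EdgeType → Bool) → EdgeType → Bool
unsafeIn P t = P t ∧ EdgeType.unsafeEdge t

module EdgeCounting (G : Graph) (A B C : VSet G) where

  ⟦_⟧ : Region → VSet G
  ⟦ φ ⟧ v = φ (A v) (B v) (C v)

  typeOf : Fin (m G) → EdgeType
  typeOf e = edgeType (A x) (B x) (C x) (A y) (B y) (C y) (unsafe G e)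
    where
    x y : Fin (n G)
    x = proj₁ (ends G e)
    y = proj₂ (ends G e)

  #_ : (EdgeType → Bool) → ℕ
  # P = count (λ e → P (typeOf e))

  #δ #δᵘ : Region → ℕ
  #δ  φ = # boundary φ
  #δᵘ φ = # unsafeIn (boundary φ)

  #E #Eᵘ : Region → Region → ℕ
  #E  φ ψ = # between φ ψ
  #Eᵘ φ ψ = # unsafeIn (between φ ψ)

  -- Inequalities between sums of edge counts, checked on each of the 2⁷ edge types; count-≤-given
  -- skips the edge types in Zs, which are known not to occur.
  count-≤-given : (Zs : List (EdgeType → Bool)) → All (λ Z → # Z ≡ 0) Zs →
    (Ps Qs : List (EdgeType → Bool)) →
    {_ : True (∀-EdgeType? λ t → T? (not (any (λ Z → Z t) Zs)) →-dec
                                  (∑ (indicators t Ps) ≤? ∑ (indicators t Qs)))} →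
    ∑ (map #_ Ps) ≤ ∑ (map #_ Qs)
  count-≤-given Zs Zs≡0 Ps Qs {ok} =
    ∑counts-mono typeOf (λ t → T (not (any (λ Z → Z t) Zs))) (absent Zs Zs≡0) Ps Qs (toWitness ok)
    where
    absent : ∀ Zs → All (λ Z → # Z ≡ 0) Zs → ∀ e → T (not (any (λ Z → Z (typeOf e)) Zs))
    absent []       All.[]               e = _
    absent (Z ∷ Zs) (Z≡0 All.∷ Zs≡0) e =
      none-∷ (count≡0⇒false (λ e → Z (typeOf e)) Z≡0 e) (absent Zs Zs≡0 e)
      where
      none-∷ : ∀ {b bs} → b ≡ false → T (not bs) → T (not (b ∨ bs))
      none-∷ refl t = t

  count-≤ : (Ps Qs : List (EdgeType → Bool)) →
    {_ : True (∀-EdgeType? λ t → ∑ (indicators t Ps) ≤? ∑ (indicators t Qs))} →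
    ∑ (map #_ Ps) ≤ ∑ (map #_ Qs)
  count-≤ Ps Qs {ok} = ∑counts-mono typeOf (λ _ → ⊤) _ Ps Qs (λ t _ → toWitness ok t)

  count-≡ : (Ps Qs : List (EdgeType → Bool)) →
    {_ : True (∀-EdgeType? λ t → ∑ (indicators t Ps) ≤? ∑ (indicators t Qs))} →
    {_ : True (∀-EdgeType? λ t → ∑ (indicators t Qs) ≤? ∑ (indicators t Ps))} →
    ∑ (map #_ Ps) ≡ ∑ (map #_ Qs)
  count-≡ Ps Qs {ok₁} {ok₂} = ≤-antisym (count-≤ Ps Qs {ok₁}) (count-≤ Qs Ps {ok₂})

  nonempty-⊆ : (φ ψ : Region) →
    {_ : True (∀-Bool³? λ a b c → (φ a b c ≟ᵇ true) →-dec (ψ a b c ≟ᵇ true))} →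
    Nonempty ⟦ φ ⟧ → Nonempty ⟦ ψ ⟧
  nonempty-⊆ φ ψ {ok} (v , φv) = v , toWitness ok (A v) (B v) (C v) φv

  cut-bound : ∀ {p} → FlexConnected G p → (φ ψ : Region) →
    {_ : True (∀-Bool³? λ a b c → (ψ a b c ≟ᵇ true) →-dec (∁ʳ φ a b c ≟ᵇ true))} →
    Nonempty ⟦ φ ⟧ → Nonempty ⟦ ψ ⟧ → p + 2 ⊓ #δᵘ φ ≤ #δ φ
  cut-bound flex φ ψ {ψ⊆∁φ} φ≠∅ ψ≠∅ = flex-cut-bound flex ⟦ φ ⟧ φ≠∅ (nonempty-⊆ ψ (∁ʳ φ) {ψ⊆∁φ} ψ≠∅)

  between-nonempty : (φ ψ : Region) → 1 ≤ #E φ ψ → Nonempty ⟦ φ ⟧ × Nonempty ⟦ ψ ⟧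
  between-nonempty φ ψ 1≤E =
    let e , e∈E = count-pos⇒∃ (λ e → between φ ψ (typeOf e)) 1≤E
    in  ends-in (proj₁ (ends G e)) (proj₂ (ends G e)) e∈E
    where
    ends-in : ∀ x y → ((⟦ φ ⟧ x ∧ ⟦ ψ ⟧ y) ∨ (⟦ ψ ⟧ x ∧ ⟦ φ ⟧ y)) ≡ true → Nonempty ⟦ φ ⟧ × Nonempty ⟦ ψ ⟧
    ends-in x y h with ⟦ φ ⟧ x in φx | ⟦ ψ ⟧ y in ψy | ⟦ ψ ⟧ x in ψx | ⟦ φ ⟧ y in φy
    ... | true  | true  | _    | _    = (x , φx) , (y , ψy)
    ... | true  | false | true | true = (y , φy) , (x , ψx)
    ... | false | _     | true | true = (y , φy) , (x , ψx)

nonempty? : ∀ {k} (S : Fin k → Bool) → Dec (Nonempty S)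
nonempty? S = any? (λ v → S v ≟ᵇ true)

module _ {G : Graph} where

  violated-compl : ∀ {p} (S : VSet G) → Violated G p S → Violated G p (compl S)
  violated-compl S (∣δS∣ , 3≤δᵘS) =
    trans (count-≡ (boundary (∁ʳ isA) ∷ []) (boundary isA ∷ [])) ∣δS∣ ,
    ≤-trans 3≤δᵘS (count-≤ (unsafeIn (boundary isA) ∷ []) (unsafeIn (boundary (∁ʳ isA)) ∷ []))
    where open EdgeCounting G S S S

  cross-compl : ∀ {S T : VSet G} → Cross G S T → Cross G S (compl T)
  cross-compl {S} {T} (S∖T , S∩T , T∖S , ∁[S∪T]) =
    nonempty-⊆ (isA ∩ʳ isB) (isA ∖ʳ ∁ʳ isB) S∩T ,
    S∖T ,
    nonempty-⊆ (∁ʳ (isA ∪ʳ isB)) (∁ʳ isB ∖ʳ isA) ∁[S∪T] ,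
    nonempty-⊆ (isB ∖ʳ isA) (∁ʳ (isA ∪ʳ ∁ʳ isB)) T∖S
    where open EdgeCounting G S T T

  cross? : (S T : VSet G) → Dec (Cross G S T)
  cross? S T = nonempty? _ ×-dec nonempty? _ ×-dec nonempty? _ ×-dec nonempty? _

  noUnsafeEdge? : (F : ESet G) → Dec (NoUnsafeEdge G F)
  noUnsafeEdge? F = all? λ e → (F e ≟ᵇ true) →-dec (unsafe G e ≟ᵇ false)

  noUnsafeEdge⇒count≡0 : (F : ESet G) → NoUnsafeEdge G F → count (λ e → F e ∧ unsafe G e) ≡ 0
  noUnsafeEdge⇒count≡0 F safe = false⇒count≡0 _ F∧unsafe≡false
    where
    F∧unsafe≡false : ∀ e → (F e ∧ unsafe G e) ≡ false
    F∧unsafe≡false e with F e in Fe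
    ... | true  = safe e Fe
    ... | false = refl

  count≡0⇒noUnsafeEdge : (F : ESet G) → count (λ e → F e ∧ unsafe G e) ≡ 0 → NoUnsafeEdge G F
  count≡0⇒noUnsafeEdge F count≡0 e Fe =
    subst (λ b → (b ∧ unsafe G e) ≡ false) Fe (count≡0⇒false _ count≡0 e)

  ¬noUnsafeEdge⇒1≤count : (F : ESet G) → ¬ NoUnsafeEdge G F → 1 ≤ count (λ e → F e ∧ unsafe G e)
  ¬noUnsafeEdge⇒1≤count F ¬safe = n≢0⇒n>0 (¬safe ∘ count≡0⇒noUnsafeEdge F)

  noUnsafeEdge-compl : ∀ {S T : VSet G} → NoUnsafeEdge G (Ebetween G (S ∖ T) (compl (S ∪ T))) →
    NoUnsafeEdge G (Ebetween G (S ∩ compl T) (compl T ∖ S))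
  noUnsafeEdge-compl {S} {T} safe = count≡0⇒noUnsafeEdge _ (n≤0⇒n≡0 (≤-trans
    (count-≤ (unsafeIn (between (isA ∖ʳ isB) (∁ʳ isB ∖ʳ isA)) ∷ [])
             (unsafeIn (between (isA ∖ʳ isB) (∁ʳ (isA ∪ʳ isB))) ∷ []))
    (≤-reflexive (noUnsafeEdge⇒count≡0 (Ebetween G (S ∖ T) (compl (S ∪ T))) safe))))
    where open EdgeCounting G S T T

parity[n+n]≡0ℙ : ∀ n → parity (n + n) ≡ 0ℙ
parity[n+n]≡0ℙ zero    = refl
parity[n+n]≡0ℙ (suc n) rewrite +-suc n n = parity[n+n]≡0ℙ n

parity[1+n+n]≡1ℙ : ∀ n → parity (suc (n + n)) ≡ 1ℙ
parity[1+n+n]≡1ℙ zero    = refl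
parity[1+n+n]≡1ℙ (suc n) rewrite +-suc n n = parity[1+n+n]≡1ℙ n

odd≢n+n : ∀ {p} n → Odd p → p ≢ n + n
odd≢n+n n (k , refl) eq = 1ℙ≢0ℙ (begin
  1ℙ                    ≡⟨ parity[1+n+n]≡1ℙ k ⟨
  parity (suc (k + k))  ≡⟨ cong (λ m → parity (suc (k + m))) (+-identityʳ k) ⟨
  parity (suc (2 * k))  ≡⟨ cong parity eq ⟩
  parity (n + n)        ≡⟨ parity[n+n]≡0ℙ n ⟩
  0ℙ                    ∎)
  where
  open ≡-Reasoning
  1ℙ≢0ℙ : 1ℙ ≢ 0ℙ
  1ℙ≢0ℙ ()

odd-+2 : ∀ {p} → Odd p → Odd (p + 2)
odd-+2 (k , refl) = suc k , solve (k ∷ [])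

odd<n+n : ∀ {p} n → Odd p → p ≤ n + n → p < n + n
odd<n+n n odd p≤n+n = ≤∧≢⇒< p≤n+n (odd≢n+n n odd)

n+n<odd : ∀ {p} n → Odd p → n + n ≤ p → n + n < p
n+n<odd n odd n+n≤p = ≤∧≢⇒< n+n≤p (odd≢n+n n odd ∘ sym)

refute-≤ : ∀ {m n} → m ≤ n → {False (m ≤? n)} → ⊥
refute-≤ m≤n {m≰n} = toWitnessFalse m≰n m≤n

⊓-subadditive : ∀ n a b → n ⊓ (a + b) ≤ n ⊓ a + n ⊓ b
⊓-subadditive n a b with ≤-total n a | ≤-total n b
... | inj₁ n≤a | _ = begin
  n ⊓ (a + b)      ≤⟨ m⊓n≤m n (a + b) ⟩
  n                ≡⟨ m≤n⇒m⊓n≡m n≤a ⟨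
  n ⊓ a            ≤⟨ m≤m+n (n ⊓ a) (n ⊓ b) ⟩
  n ⊓ a + n ⊓ b    ∎
  where open ≤-Reasoning
... | inj₂ a≤n | inj₁ n≤b = begin
  n ⊓ (a + b)      ≤⟨ m⊓n≤m n (a + b) ⟩
  n                ≤⟨ m≤n+m n a ⟩
  a + n            ≡⟨ cong₂ _+_ (m≥n⇒m⊓n≡n a≤n) (m≤n⇒m⊓n≡m n≤b) ⟨
  n ⊓ a + n ⊓ b    ∎
  where open ≤-Reasoning
... | inj₂ a≤n | inj₂ b≤n = begin
  n ⊓ (a + b)      ≤⟨ m⊓n≤n n (a + b) ⟩
  a + b            ≡⟨ cong₂ _+_ (m≥n⇒m⊓n≡n a≤n) (m≥n⇒m⊓n≡n b≤n) ⟨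
  n ⊓ a + n ⊓ b    ∎
  where open ≤-Reasoning

1≤2⊓ : ∀ {u} → 1 ≤ u → 1 ≤ 2 ⊓ u
1≤2⊓ = ⊓-glb (s≤s z≤n)

2≤2⊓u+2⊓v : ∀ {u v} → 3 ≤ u + v → 2 ≤ 2 ⊓ u + 2 ⊓ v
2≤2⊓u+2⊓v {u} {v} 3≤u+v = ≤-trans (⊓-glb ≤-refl (≤-trans (n≤1+n 2) 3≤u+v)) (⊓-subadditive 2 u v)

3≤2⊓u+2⊓v : ∀ {u v} → 1 ≤ u → 1 ≤ v → 3 ≤ u + v → 3 ≤ 2 ⊓ u + 2 ⊓ v
3≤2⊓u+2⊓v {1}           {suc (suc v)} _ _ _        = ≤-refl
3≤2⊓u+2⊓v {1}           {1}           _ _ 3≤2      = ⊥-elim (refute-≤ 3≤2)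
3≤2⊓u+2⊓v {suc (suc u)} {suc v}       _ _ _        = s≤s (s≤s (s≤s z≤n))

1≤2⊓-sum : ∀ {a b c d} → 1 ≤ a + (b + (c + d)) → 1 ≤ 2 ⊓ a + (2 ⊓ b + (2 ⊓ c + 2 ⊓ d))
1≤2⊓-sum {a} {b} {c} {d} 1≤sum = begin
  1                                     ≤⟨ 1≤2⊓ 1≤sum ⟩
  2 ⊓ (a + (b + (c + d)))               ≤⟨ ⊓-subadditive 2 a _ ⟩
  2 ⊓ a + 2 ⊓ (b + (c + d))             ≤⟨ +-monoʳ-≤ (2 ⊓ a) (⊓-subadditive 2 b _) ⟩
  2 ⊓ a + (2 ⊓ b + 2 ⊓ (c + d))         ≤⟨ +-monoʳ-≤ (2 ⊓ a) (+-monoʳ-≤ (2 ⊓ b) (⊓-subadditive 2 c d)) ⟩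
  2 ⊓ a + (2 ⊓ b + (2 ⊓ c + 2 ⊓ d))     ∎
  where open ≤-Reasoning

flex-bound-2 : ∀ {p u d} → 2 ≤ u → p + 2 ⊓ u ≤ d → p + 2 ≤ d
flex-bound-2 {p} 2≤u = ≤-trans (≤-reflexive (cong (p +_) (sym (m≤n⇒m⊓n≡m 2≤u))))

pair-excess : ∀ {p a b x y X} → p + a ≤ x → p + b ≤ y → x + y ≤ (p + 2) + X → p + (a + b) ≤ 2 + X
pair-excess {p} {a} {b} {x} {y} {X} pa≤x pb≤y x+y≤ = +-cancelˡ-≤ p _ _ (begin
  p + (p + (a + b))  ≡⟨ solve (p ∷ a ∷ b ∷ []) ⟩
  (p + a) + (p + b)  ≤⟨ +-mono-≤ pa≤x pb≤y ⟩
  x + y              ≤⟨ x+y≤ ⟩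
  (p + 2) + X        ≡⟨ solve (p ∷ X ∷ []) ⟩
  p + (2 + X)        ∎)
  where open ≤-Reasoning

pair-bound : ∀ {p a b x y t} → Odd p → p + a ≤ x → p + b ≤ y → x + y ≤ (p + 2) + (t + t) →
  2 ≤ a + b → p < t + t
pair-bound {p} {a} {b} {x} {y} {t} odd pa≤x pb≤y x+y≤ 2≤a+b =
  odd<n+n t odd (+-cancelˡ-≤ 2 p (t + t) (begin
    2 + p          ≡⟨ +-comm 2 p ⟩
    p + 2          ≤⟨ +-monoʳ-≤ p 2≤a+b ⟩
    p + (a + b)    ≤⟨ pair-excess {p} pa≤x pb≤y x+y≤ ⟩
    2 + (t + t)    ∎))
  where open ≤-Reasoning

2+k+2+k≰3 : ∀ k → ¬ suc (suc k) + suc (suc k) ≤ 3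
2+k+2+k≰3 k h = refute-≤ (m+n≤o⇒n≤o k (≤-pred (≤-pred h)))

diagonal-cases : ∀ a b k → 2 ⊓ a + (2 ⊓ b + (k + k)) ≤ 4 → 6 ≤ a + (b + (k + k)) →
  k ≡ 0 ⊎ (k ≡ 1 × a ≡ 0 × 2 ≤ b) ⊎ (k ≡ 1 × b ≡ 0 × 2 ≤ a)
diagonal-cases a b 0 _ _ = inj₁ refl
diagonal-cases 0 b 1 _ 6≤b+2 =
  inj₂ (inj₁ (refl , refl , +-cancelʳ-≤ 2 2 b (≤-trans (m≤m+n 4 2) 6≤b+2)))
diagonal-cases (suc a) 0 1 _ 6≤a+2 =
  inj₂ (inj₂ (refl , refl , +-cancelʳ-≤ 2 2 (suc a) (≤-trans (m≤m+n 4 2) 6≤a+2)))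
diagonal-cases 1 1 1 _ h = ⊥-elim (refute-≤ h)
diagonal-cases 1 (suc (suc b)) 1 h _ = ⊥-elim (refute-≤ h)
diagonal-cases (suc (suc a)) (suc b) 1 h _ =
  ⊥-elim (refute-≤ (m+n≤o⇒n≤o (1 ⊓ b) (≤-pred (≤-pred (≤-pred h)))))
diagonal-cases 0 0 (suc (suc k)) h h′ = ⊥-elim (refute-≤ (≤-trans h′ h))
diagonal-cases (suc a) b (suc (suc k)) h _ =
  ⊥-elim (2+k+2+k≰3 k (m+n≤o⇒n≤o (2 ⊓ b) (m+n≤o⇒n≤o (1 ⊓ a) (≤-pred h))))
diagonal-cases 0 (suc b) (suc (suc k)) h _ =
  ⊥-elim (2+k+2+k≰3 k (m+n≤o⇒n≤o (1 ⊓ b) (≤-pred h)))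

other-side-unsafe : ∀ {u v w} → 3 ≤ u → u ≤ v + w → v ≡ 0 → 2 ≤ w
other-side-unsafe 3≤u u≤v+w refl = ≤-trans (n≤1+n 2) (≤-trans 3≤u u≤v+w)

odd-even-gap : ∀ {p z α} → Odd p → p + z ≡ (p + 2) + (α + α) → p + 2 ≤ z → p + 2 < z
odd-even-gap {p} {z} {α} odd p+z≡ z≥ =
  subst (p + 2 <_) (sym z≡2+2α) (odd<n+n (suc α) (odd-+2 odd) (subst (p + 2 ≤_) z≡2+2α z≥))
  where
  z≡2+2α : z ≡ suc α + suc α
  z≡2+2α = +-cancelˡ-≡ p z _ (trans p+z≡ (solve (p ∷ α ∷ [])))

-- A quadrant of degree exactly p forces, by parity, degree at least p + 3 on both its neighbours.
degree-p-quadrant-impossible : ∀ {p x y z w α β} → Odd p →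
  p ≤ x → p + 2 ≤ y → x + (y + 2) ≤ (p + 2) + (p + 2) →
  x + z ≡ (p + 2) + (α + α) → x + w ≡ (p + 2) + (β + β) →
  p + 2 ≤ z → p + 2 ≤ w → z + w ≤ (p + 2) + (p + 2) → ⊥
degree-p-quadrant-impossible {p} {x} {y} {z} {w} {α} {β} odd p≤x y≥ x+y+2≤ x+z≡ x+w≡ z≥ w≥ z+w≤ =
  1+n≰n (≤-trans (s≤s (+-monoʳ-≤ (p + 2) (n≤1+n (p + 2)))) (≤-trans (+-mono-≤ z> w>) z+w≤))
  where
  x≤p : x ≤ p
  x≤p = +-cancelʳ-≤ (p + 4) x p (begin
    x + (p + 4)        ≡⟨ cong (x +_) (+-assoc p 2 2) ⟨
    x + ((p + 2) + 2)  ≤⟨ +-monoʳ-≤ x (+-monoˡ-≤ 2 y≥) ⟩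
    x + (y + 2)        ≤⟨ x+y+2≤ ⟩
    (p + 2) + (p + 2)  ≡⟨ solve (p ∷ []) ⟩
    p + (p + 4)        ∎)
    where open ≤-Reasoning
  x≡p : x ≡ p
  x≡p = ≤-antisym x≤p p≤x
  z> : p + 2 < z
  z> = odd-even-gap {α = α} odd (subst (λ x → x + z ≡ _) x≡p x+z≡) z≥
  w> : p + 2 < w
  w> = odd-even-gap {α = β} odd (subst (λ x → x + w ≡ _) x≡p x+w≡) w≥

smaller-double : ∀ {p c c′} → Odd p → c ≤ c′ → c + c′ ≤ p + 2 → c + c ≤ suc p
smaller-double {p} {c} {c′} odd c≤c′ c+c′≤ =
  ≤-pred (subst (suc (c + c) ≤_) (+-comm p 2)
    (n+n<odd c (odd-+2 odd) (≤-trans (+-monoʳ-≤ c c≤c′) c+c′≤)))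

at-most-one : ∀ {p c u₁ u₂ w} → p + (2 ⊓ u₁ + 2 ⊓ u₂) ≤ 2 + (c + c) → c + c ≤ suc p →
  w ≤ u₁ → w ≤ u₂ → w ≤ 1
at-most-one {p} {c} {u₁} {u₂} {w} excess c+c≤ w≤u₁ w≤u₂ with w ≤? 1
... | yes w≤1 = w≤1
... | no  w≰1 = ⊥-elim (1+n≰n (begin
  suc (p + 3)               ≡⟨ solve (p ∷ []) ⟩
  p + (2 + 2)               ≡⟨ cong₂ (λ m n → p + (m + n)) (min2 w≤u₁) (min2 w≤u₂) ⟨
  p + (2 ⊓ u₁ + 2 ⊓ u₂)     ≤⟨ excess ⟩
  2 + (c + c)               ≤⟨ +-monoʳ-≤ 2 c+c≤ ⟩
  2 + suc p                 ≡⟨ solve (p ∷ []) ⟩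
  p + 3                     ∎))
  where
  open ≤-Reasoning
  min2 : ∀ {u} → w ≤ u → 2 ⊓ u ≡ 2
  min2 w≤u = m≤n⇒m⊓n≡m (≤-trans (≰⇒> w≰1) w≤u)

-- In use, c and c′ count the edges across A outside and inside C, t those inside B, and s, s′ (r, r′)
-- those inside the two cells outside (inside) B.
straddles : ∀ {p t c c′ s s′ r r′} → s + r ≤ c → s′ + r′ ≤ c′ → c + c′ ≤ p + 2 → t ≤ r + r′ →
  p < t + t → p < c + c → c + c ≤ suc p → 1 ≤ s → 2 ≤ s′ → 1 ≤ r × 1 ≤ r′
straddles {p} {t} {c} {c′} {s} {s′} {zero} {r′} s+r≤c s′+r′≤c′ c+c′≤ t≤r′ p<t+t p<c+c _ _ 2≤s′ =
  ⊥-elim (1+n≰n (begin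
    suc ((p + 2) + (p + 2))              ≤⟨ n≤1+n _ ⟩
    suc (suc ((p + 2) + (p + 2)))        ≡⟨ solve (p ∷ []) ⟩
    suc p + (4 + suc p)                  ≤⟨ +-mono-≤ p<c+c (+-monoʳ-≤ 4 p<t+t) ⟩
    (c + c) + (4 + (t + t))              ≡⟨ cong ((c + c) +_) (solve (t ∷ [])) ⟩
    (c + c) + ((2 + t) + (2 + t))        ≤⟨ +-monoʳ-≤ (c + c) (+-mono-≤ 2+t≤c′ 2+t≤c′) ⟩
    (c + c) + (c′ + c′)                  ≡⟨ interchange c c′ c c′ ⟨
    (c + c′) + (c + c′)                  ≤⟨ +-mono-≤ c+c′≤ c+c′≤ ⟩
    (p + 2) + (p + 2)                    ∎))
  where
  open ≤-Reasoning
  2+t≤c′ : 2 + t ≤ c′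
  2+t≤c′ = ≤-trans (+-mono-≤ 2≤s′ t≤r′) s′+r′≤c′
straddles {p} {t} {c} {c′} {s} {s′} {suc r} {zero} s+r≤c _ _ t≤r p<t+t _ c+c≤ 1≤s _ =
  ⊥-elim (1+n≰n (begin
    suc (t + t)          ≤⟨ n≤1+n _ ⟩
    suc (suc (t + t))    ≡⟨ cong suc (+-suc t t) ⟨
    suc t + suc t        ≤⟨ +-mono-≤ 1+t≤c 1+t≤c ⟩
    c + c                ≤⟨ c+c≤ ⟩
    suc p                ≤⟨ p<t+t ⟩
    t + t                ∎))
  where
  open ≤-Reasoning
  1+t≤c : suc t ≤ c
  1+t≤c = ≤-trans (+-mono-≤ 1≤s (≤-trans t≤r (≤-reflexive (+-identityʳ _)))) s+r≤c
straddles {r = suc _} {r′ = suc _} _ _ _ _ _ _ _ _ _ = s≤s z≤n , s≤s z≤n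

straddles-beside-smaller-cut : ∀ {p t c c′ x₁ x₂ s s′ sᵘ sᵘ′ r r′} → Odd p →
  p + (2 ⊓ x₁ + 2 ⊓ x₂) ≤ 2 + (c + c) → sᵘ ≤ x₁ → sᵘ ≤ x₂ →
  3 ≤ sᵘ + sᵘ′ → 1 ≤ sᵘ → sᵘ ≤ s → sᵘ′ ≤ s′ →
  s + r ≤ c → s′ + r′ ≤ c′ → c + c′ ≤ p + 2 → c ≤ c′ →
  t ≤ r + r′ → p < t + t → p < c + c → 1 ≤ r × 1 ≤ r′
straddles-beside-smaller-cut {p} {c = c} {sᵘ′ = sᵘ′} odd excess sᵘ≤x₁ sᵘ≤x₂ 3≤sᵘ+sᵘ′ 1≤sᵘ sᵘ≤s sᵘ′≤s′
  s+r≤c s′+r′≤c′ c+c′≤ c≤c′ t≤r+r′ p<t+t p<c+c =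
  straddles s+r≤c s′+r′≤c′ c+c′≤ t≤r+r′ p<t+t p<c+c c+c≤ (≤-trans 1≤sᵘ sᵘ≤s) (≤-trans 2≤sᵘ′ sᵘ′≤s′)
  where
  c+c≤ : c + c ≤ suc p
  c+c≤ = smaller-double odd c≤c′ c+c′≤
  2≤sᵘ′ : 2 ≤ sᵘ′
  2≤sᵘ′ = +-cancelˡ-≤ 1 2 sᵘ′ (≤-trans 3≤sᵘ+sᵘ′ (+-monoˡ-≤ sᵘ′ (at-most-one {c = c} excess c+c≤ sᵘ≤x₁ sᵘ≤x₂)))

7≤b₁+b₂+b₃+b₄+r : ∀ {m₀ m₁ b₁ b₂ b₃ b₄ r} → 3 ≤ m₀ + m₁ → m₀ ≤ b₁ → m₀ ≤ b₂ → m₁ ≤ b₃ → m₁ ≤ b₄ →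
  1 ≤ r → 7 ≤ b₁ + (b₂ + (b₃ + (b₄ + r)))
7≤b₁+b₂+b₃+b₄+r {m₀} {m₁} {b₁} {b₂} {b₃} {b₄} {r} 3≤m₀+m₁ m₀≤b₁ m₀≤b₂ m₁≤b₃ m₁≤b₄ 1≤r = begin
  7                                 ≤⟨ +-monoˡ-≤ 1 (+-mono-≤ 3≤m₀+m₁ 3≤m₀+m₁) ⟩
  (m₀ + m₁) + (m₀ + m₁) + 1         ≡⟨ solve (m₀ ∷ m₁ ∷ []) ⟩
  m₀ + (m₀ + (m₁ + (m₁ + 1)))       ≤⟨ +-mono-≤ m₀≤b₁ (+-mono-≤ m₀≤b₂ (+-mono-≤ m₁≤b₃ (+-monoˡ-≤ 1 m₁≤b₄))) ⟩
  b₁ + (b₂ + (b₃ + (b₄ + 1)))       ≤⟨ +-monoʳ-≤ b₁ (+-monoʳ-≤ b₂ (+-monoʳ-≤ b₃ (+-monoʳ-≤ b₄ 1≤r))) ⟩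
  b₁ + (b₂ + (b₃ + (b₄ + r)))       ∎
  where open ≤-Reasoning

8p+7≰6[p+2] : ∀ {p β} → 3 ≤ p → 7 ≤ β → ¬ 8 * p + β ≤ 6 * (p + 2)
8p+7≰6[p+2] {p} {β} 3≤p 7≤β 8p+β≤ = refute-≤ (begin
  2 * 3 + 7         ≤⟨ +-monoˡ-≤ 7 (*-monoʳ-≤ 2 3≤p) ⟩
  2 * p + 7         ≤⟨ +-cancelˡ-≤ (6 * p) _ _ (begin
    6 * p + (2 * p + 7)  ≡⟨ solve (p ∷ []) ⟩
    8 * p + 7            ≤⟨ +-monoʳ-≤ (8 * p) 7≤β ⟩
    8 * p + β            ≤⟨ 8p+β≤ ⟩
    6 * (p + 2)          ≡⟨ solve (p ∷ []) ⟩
    6 * p + 12           ∎) ⟩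
  12                ∎)
  where open ≤-Reasoning

-- Crossing violated sets

module CrossingViolated {p} (odd : Odd p) {G} (flex : FlexConnected G p) (S T : VSet G)
  (vS : Violated G p S) (vT : Violated G p T) (S⋈T : Cross G S T) where

  open EdgeCounting G S T T

  q₁ q₂ q₃ q₄ : Region
  q₁ = isA ∖ʳ isB
  q₂ = isA ∩ʳ isB
  q₃ = isB ∖ʳ isA
  q₄ = ∁ʳ (isA ∪ʳ isB)

  ∣δS∣+∣δT∣ : #δ isA + #δ isB ≡ (p + 2) + (p + 2)
  ∣δS∣+∣δT∣ = cong₂ _+_ (proj₁ vS) (proj₁ vT)

  flex₁ : p + 2 ⊓ #δᵘ q₁ ≤ #δ q₁
  flex₁ = cut-bound flex q₁ q₂ (proj₁ S⋈T) (proj₁ (proj₂ S⋈T))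
  flex₂ : p + 2 ⊓ #δᵘ q₂ ≤ #δ q₂
  flex₂ = cut-bound flex q₂ q₁ (proj₁ (proj₂ S⋈T)) (proj₁ S⋈T)
  flex₃ : p + 2 ⊓ #δᵘ q₃ ≤ #δ q₃
  flex₃ = cut-bound flex q₃ q₁ (proj₁ (proj₂ (proj₂ S⋈T))) (proj₁ S⋈T)
  flex₄ : p + 2 ⊓ #δᵘ q₄ ≤ #δ q₄
  flex₄ = cut-bound flex q₄ q₁ (proj₂ (proj₂ (proj₂ S⋈T))) (proj₁ S⋈T)

  k : ℕ
  k = #E q₂ q₄

  cut₁₃ : #δ q₁ + (#δ q₃ + (k + k)) ≤ (p + 2) + (p + 2)
  cut₁₃ = ≤-trans (count-≤ (boundary q₁ ∷ boundary q₃ ∷ between q₂ q₄ ∷ between q₂ q₄ ∷ [])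
                           (boundary isA ∷ boundary isB ∷ []))
                  (≤-reflexive ∣δS∣+∣δT∣)
  cut₃₁ : #δ q₃ + (#δ q₁ + (k + k)) ≤ (p + 2) + (p + 2)
  cut₃₁ = ≤-trans (count-≤ (boundary q₃ ∷ boundary q₁ ∷ between q₂ q₄ ∷ between q₂ q₄ ∷ [])
                           (boundary isA ∷ boundary isB ∷ []))
                  (≤-reflexive ∣δS∣+∣δT∣)
  cut₂₄ : #δ q₂ + #δ q₄ ≤ (p + 2) + (p + 2)
  cut₂₄ = ≤-trans (count-≤ (boundary q₂ ∷ boundary q₄ ∷ []) (boundary isA ∷ boundary isB ∷ []))
                  (≤-reflexive ∣δS∣+∣δT∣)

  unsafe₁₃ : 6 ≤ #δᵘ q₁ + (#δᵘ q₃ + (k + k))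
  unsafe₁₃ = ≤-trans (+-mono-≤ (proj₂ vS) (proj₂ vT))
    (count-≤ (unsafeIn (boundary isA) ∷ unsafeIn (boundary isB) ∷ [])
             (unsafeIn (boundary q₁) ∷ unsafeIn (boundary q₃) ∷ between q₂ q₄ ∷ between q₂ q₄ ∷ []))

  E₁₂ E₁₄ E₃₂ E₃₄ : ℕ
  E₁₂ = #E q₁ q₂
  E₁₄ = #E q₁ q₄
  E₃₂ = #E q₃ q₂
  E₃₄ = #E q₃ q₄

  parity₁₂ : #δ q₁ + #δ q₂ ≡ (p + 2) + (E₁₂ + E₁₂)
  parity₁₂ = trans (count-≡ (boundary q₁ ∷ boundary q₂ ∷ []) (boundary isA ∷ between q₁ q₂ ∷ between q₁ q₂ ∷ []))
                   (cong (_+ (E₁₂ + E₁₂)) (proj₁ vS))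
  parity₁₄ : #δ q₁ + #δ q₄ ≡ (p + 2) + (E₁₄ + E₁₄)
  parity₁₄ = trans (count-≡ (boundary q₁ ∷ boundary q₄ ∷ []) (boundary isB ∷ between q₁ q₄ ∷ between q₁ q₄ ∷ []))
                   (cong (_+ (E₁₄ + E₁₄)) (proj₁ vT))
  parity₃₂ : #δ q₃ + #δ q₂ ≡ (p + 2) + (E₃₂ + E₃₂)
  parity₃₂ = trans (count-≡ (boundary q₃ ∷ boundary q₂ ∷ []) (boundary isB ∷ between q₃ q₂ ∷ between q₃ q₂ ∷ []))
                   (cong (_+ (E₃₂ + E₃₂)) (proj₁ vT))
  parity₃₄ : #δ q₃ + #δ q₄ ≡ (p + 2) + (E₃₄ + E₃₄)
  parity₃₄ = trans (count-≡ (boundary q₃ ∷ boundary q₄ ∷ []) (boundary isA ∷ between q₃ q₄ ∷ between q₃ q₄ ∷ []))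
                   (cong (_+ (E₃₄ + E₃₄)) (proj₁ vS))

  unsafe₁₂ : #δᵘ isA ≤ #δᵘ q₁ + #δᵘ q₂
  unsafe₁₂ = count-≤ (unsafeIn (boundary isA) ∷ []) (unsafeIn (boundary q₁) ∷ unsafeIn (boundary q₂) ∷ [])
  unsafe₁₄ : #δᵘ isB ≤ #δᵘ q₁ + #δᵘ q₄
  unsafe₁₄ = count-≤ (unsafeIn (boundary isB) ∷ []) (unsafeIn (boundary q₁) ∷ unsafeIn (boundary q₄) ∷ [])
  unsafe₃₂ : #δᵘ isB ≤ #δᵘ q₃ + #δᵘ q₂
  unsafe₃₂ = count-≤ (unsafeIn (boundary isB) ∷ []) (unsafeIn (boundary q₃) ∷ unsafeIn (boundary q₂) ∷ [])
  unsafe₃₄ : #δᵘ isA ≤ #δᵘ q₃ + #δᵘ q₄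
  unsafe₃₄ = count-≤ (unsafeIn (boundary isA) ∷ []) (unsafeIn (boundary q₃) ∷ unsafeIn (boundary q₄) ∷ [])

  at-k≡1 : ∀ {x y} → k ≡ 1 → x + (y + (k + k)) ≤ (p + 2) + (p + 2) → x + (y + 2) ≤ (p + 2) + (p + 2)
  at-k≡1 {x} {y} = subst (λ k → x + (y + (k + k)) ≤ (p + 2) + (p + 2))

  excess₁₃ : 2 ⊓ #δᵘ q₁ + (2 ⊓ #δᵘ q₃ + (k + k)) ≤ 4
  excess₁₃ = +-cancelˡ-≤ p _ 4 (begin
    p + (2 ⊓ #δᵘ q₁ + (2 ⊓ #δᵘ q₃ + (k + k)))  ≤⟨ pair-excess {p} flex₁ flex₃+2k cut₁₃ ⟩
    2 + (p + 2)                                ≡⟨ solve (p ∷ []) ⟩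
    p + 4                                      ∎)
    where
    open ≤-Reasoning
    flex₃+2k : p + (2 ⊓ #δᵘ q₃ + (k + k)) ≤ #δ q₃ + (k + k)
    flex₃+2k = ≤-trans (≤-reflexive (sym (+-assoc p _ (k + k)))) (+-monoˡ-≤ (k + k) flex₃)

  inner-outer-empty : #E q₂ q₄ ≡ 0
  inner-outer-empty with diagonal-cases (#δᵘ q₁) (#δᵘ q₃) k excess₁₃ unsafe₁₃
  ... | inj₁ k≡0 = k≡0
  ... | inj₂ (inj₁ (k≡1 , u₁≡0 , 2≤u₃)) =
    ⊥-elim (degree-p-quadrant-impossible {α = E₁₂} {β = E₁₄} odd
      (m+n≤o⇒m≤o p flex₁) (flex-bound-2 2≤u₃ flex₃) (at-k≡1 {#δ q₁} {#δ q₃} k≡1 cut₁₃)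
      parity₁₂ parity₁₄
      (flex-bound-2 (other-side-unsafe (proj₂ vS) unsafe₁₂ u₁≡0) flex₂)
      (flex-bound-2 (other-side-unsafe (proj₂ vT) unsafe₁₄ u₁≡0) flex₄)
      cut₂₄)
  ... | inj₂ (inj₂ (k≡1 , u₃≡0 , 2≤u₁)) =
    ⊥-elim (degree-p-quadrant-impossible {α = E₃₂} {β = E₃₄} odd
      (m+n≤o⇒m≤o p flex₃) (flex-bound-2 2≤u₁ flex₁) (at-k≡1 {#δ q₃} {#δ q₁} k≡1 cut₃₁)
      parity₃₂ parity₃₄
      (flex-bound-2 (other-side-unsafe (proj₂ vT) unsafe₃₂ u₃≡0) flex₂)
      (flex-bound-2 (other-side-unsafe (proj₂ vS) unsafe₃₄ u₃≡0) flex₄)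
      cut₂₄)

violated-crossing-diagonals : ∀ {p G} → Odd p → FlexConnected G p → (S T : VSet G) →
  Violated G p S → Violated G p T → Cross G S T →
  count (Ebetween G (S ∩ T) (compl (S ∪ T))) ≡ 0 × count (Ebetween G (S ∖ T) (T ∖ S)) ≡ 0
violated-crossing-diagonals {G = G} odd flex S T vS vT S⋈T =
  CrossingViolated.inner-outer-empty odd flex S T vS vT S⋈T ,
  trans (count-≡ (between (isA ∖ʳ isB) (isB ∖ʳ isA) ∷ []) (between (isA ∖ʳ isB) (∁ʳ (isA ∪ʳ ∁ʳ isB)) ∷ []))
        (CrossingViolated.inner-outer-empty odd flex S (compl T) vS (violated-compl {G} T vT)
                                             (cross-compl {G} {S} {T} S⋈T))
  where open EdgeCounting G S T T

-- Three violated sets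

atom-disjoint : ∀ x y z a b c → atom (not x) y z a b c ≡ true → not (atom x y z a b c) ≡ true
atom-disjoint true  y z true  b c ()
atom-disjoint true  y z false b c _ = refl
atom-disjoint false y z true  b c _ = refl
atom-disjoint false y z false b c ()

module NonAmenableCrossing {p} (odd : Odd p) (3≤p : 3 ≤ p) {G} (flex : FlexConnected G p)
  (A B C : VSet G) (vA : Violated G p A) (vB : Violated G p B) (vC : Violated G p C)
  (A⋈B : Cross G A B) (A⋈C : Cross G A C)
  (safe : NoUnsafeEdge G (Ebetween G (A ∩ B) (B ∖ A)))
  (¬safe₁ : ¬ NoUnsafeEdge G (Ebetween G (A ∩ C) (C ∖ A)))
  (¬safe₂ : ¬ NoUnsafeEdge G (Ebetween G (A ∖ C) (compl (A ∪ C)))) where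

  open EdgeCounting G A B C

  A∖B A∩B B∖A ∁[A∪B] A∖C A∩C C∖A ∁[A∪C] : Region
  A∖B    = isA ∖ʳ isB
  A∩B    = isA ∩ʳ isB
  B∖A    = isB ∖ʳ isA
  ∁[A∪B] = ∁ʳ (isA ∪ʳ isB)
  A∖C    = isA ∖ʳ isC
  A∩C    = isA ∩ʳ isC
  C∖A    = isC ∖ʳ isA
  ∁[A∪C] = ∁ʳ (isA ∪ʳ isC)

  -- Edges crossing A inside the cell where membership in B and C is y and z.
  across acrossᵘ : Bool → Bool → ℕ
  across  y z = #E  (atom true y z) (atom false y z)
  acrossᵘ y z = #Eᵘ (atom true y z) (atom false y z)

  -- Excluded by the crossing lemma and by the amenability of A and B.
  absent : List (EdgeType → Bool)
  absent = unsafeIn (between A∩B B∖A) ∷ between A∖B B∖A ∷ between A∩B ∁[A∪B]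
         ∷ between A∖C C∖A ∷ between A∩C ∁[A∪C] ∷ []

  absent≡0 : All (λ Z → # Z ≡ 0) absent
  absent≡0 = noUnsafeEdge⇒count≡0 {G} (Ebetween G (A ∩ B) (B ∖ A)) safe
    All.∷ proj₂ diagonals-AB All.∷ proj₁ diagonals-AB
    All.∷ proj₂ diagonals-AC All.∷ proj₁ diagonals-AC All.∷ All.[]
    where
    diagonals-AB : #E A∩B ∁[A∪B] ≡ 0 × #E A∖B B∖A ≡ 0
    diagonals-AB = violated-crossing-diagonals odd flex A B vA vB A⋈B
    diagonals-AC : #E A∩C ∁[A∪C] ≡ 0 × #E A∖C C∖A ≡ 0
    diagonals-AC = violated-crossing-diagonals odd flex A C vA vC A⋈C

  count-≤′ : (Ps Qs : List (EdgeType → Bool)) →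
    {_ : True (∀-EdgeType? λ t → T? (not (any (λ Z → Z t) absent)) →-dec
                                  (∑ (indicators t Ps) ≤? ∑ (indicators t Qs)))} →
    ∑ (map #_ Ps) ≤ ∑ (map #_ Qs)
  count-≤′ = count-≤-given absent absent≡0

  t c₀ c₁ : ℕ
  t  = #E A∩B B∖A
  c₀ = #E A∖C ∁[A∪C]
  c₁ = #E A∩C C∖A

  δᵘA≤ : #δᵘ isA ≤ acrossᵘ false false + acrossᵘ false true
  δᵘA≤ = count-≤′ (unsafeIn (boundary isA) ∷ [])
                  (unsafeIn (between (atom true false false) (atom false false false)) ∷
                   unsafeIn (between (atom true false true) (atom false false true)) ∷ [])

  1≤acrossᵘ₀₀ : 1 ≤ acrossᵘ false false
  1≤acrossᵘ₀₀ = ≤-trans (¬noUnsafeEdge⇒1≤count {G} (Ebetween G (A ∖ C) (compl (A ∪ C))) ¬safe₂)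
    (count-≤′ (unsafeIn (between A∖C ∁[A∪C]) ∷ [])
              (unsafeIn (between (atom true false false) (atom false false false)) ∷ []))

  1≤acrossᵘ₀₁ : 1 ≤ acrossᵘ false true
  1≤acrossᵘ₀₁ = ≤-trans (¬noUnsafeEdge⇒1≤count {G} (Ebetween G (A ∩ C) (C ∖ A)) ¬safe₁)
    (count-≤′ (unsafeIn (between A∩C C∖A) ∷ [])
              (unsafeIn (between (atom true false true) (atom false false true)) ∷ []))

  cut-B : #δ A∩B + #δ B∖A ≤ (p + 2) + (t + t)
  cut-B = ≤-trans (count-≤ (boundary A∩B ∷ boundary B∖A ∷ [])
                           (boundary isB ∷ between A∩B B∖A ∷ between A∩B B∖A ∷ []))
                  (≤-reflexive (cong (_+ (t + t)) (proj₁ vB)))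
  cut-C₀ : #δ A∖C + #δ ∁[A∪C] ≤ (p + 2) + (c₀ + c₀)
  cut-C₀ = ≤-trans (count-≤ (boundary A∖C ∷ boundary ∁[A∪C] ∷ [])
                            (boundary isC ∷ between A∖C ∁[A∪C] ∷ between A∖C ∁[A∪C] ∷ []))
                   (≤-reflexive (cong (_+ (c₀ + c₀)) (proj₁ vC)))
  cut-C₁ : #δ A∩C + #δ C∖A ≤ (p + 2) + (c₁ + c₁)
  cut-C₁ = ≤-trans (count-≤ (boundary A∩C ∷ boundary C∖A ∷ [])
                            (boundary isC ∷ between A∩C C∖A ∷ between A∩C C∖A ∷ []))
                   (≤-reflexive (cong (_+ (c₁ + c₁)) (proj₁ vC)))
  c₀+c₁≤ : c₀ + c₁ ≤ p + 2
  c₀+c₁≤ = ≤-trans (count-≤ (between A∖C ∁[A∪C] ∷ between A∩C C∖A ∷ []) (boundary isA ∷ []))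
                   (≤-reflexive (proj₁ vA))

  t≤ : t ≤ across true false + across true true
  t≤ = count-≤′ (between A∩B B∖A ∷ [])
                (between (atom true true false) (atom false true false) ∷
                 between (atom true true true) (atom false true true) ∷ [])
  across₀ : across false false + across true false ≤ c₀
  across₀ = count-≤ (between (atom true false false) (atom false false false) ∷
                     between (atom true true false) (atom false true false) ∷ [])
                    (between A∖C ∁[A∪C] ∷ [])
  across₁ : across false true + across true true ≤ c₁
  across₁ = count-≤ (between (atom true false true) (atom false false true) ∷
                     between (atom true true true) (atom false true true) ∷ [])
                    (between A∩C C∖A ∷ [])

  δᵘB≤ : #δᵘ isB ≤ #δᵘ A∩B + #δᵘ B∖A
  δᵘB≤ = count-≤ (unsafeIn (boundary isB) ∷ []) (unsafeIn (boundary A∩B) ∷ unsafeIn (boundary B∖A) ∷ [])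
  acrossᵘ₀₀≤A∖C : acrossᵘ false false ≤ #δᵘ A∖C
  acrossᵘ₀₀≤A∖C = count-≤ (unsafeIn (between (atom true false false) (atom false false false)) ∷ [])
                          (unsafeIn (boundary A∖C) ∷ [])
  acrossᵘ₀₀≤∁[A∪C] : acrossᵘ false false ≤ #δᵘ ∁[A∪C]
  acrossᵘ₀₀≤∁[A∪C] = count-≤ (unsafeIn (between (atom true false false) (atom false false false)) ∷ [])
                             (unsafeIn (boundary ∁[A∪C]) ∷ [])
  acrossᵘ₀₁≤A∩C : acrossᵘ false true ≤ #δᵘ A∩C
  acrossᵘ₀₁≤A∩C = count-≤ (unsafeIn (between (atom true false true) (atom false false true)) ∷ [])
                          (unsafeIn (boundary A∩C) ∷ [])
  acrossᵘ₀₁≤C∖A : acrossᵘ false true ≤ #δᵘ C∖A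
  acrossᵘ₀₁≤C∖A = count-≤ (unsafeIn (between (atom true false true) (atom false false true)) ∷ [])
                          (unsafeIn (boundary C∖A) ∷ [])
  acrossᵘ₀₀≤across₀₀ : acrossᵘ false false ≤ across false false
  acrossᵘ₀₀≤across₀₀ = count-≤ (unsafeIn (between (atom true false false) (atom false false false)) ∷ [])
                               (between (atom true false false) (atom false false false) ∷ [])
  acrossᵘ₀₁≤across₀₁ : acrossᵘ false true ≤ across false true
  acrossᵘ₀₁≤across₀₁ = count-≤ (unsafeIn (between (atom true false true) (atom false false true)) ∷ [])
                               (between (atom true false true) (atom false false true) ∷ [])

  flex-A∩B : p + 2 ⊓ #δᵘ A∩B ≤ #δ A∩B
  flex-A∩B = cut-bound flex A∩B A∖B (proj₁ (proj₂ A⋈B)) (proj₁ A⋈B)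
  flex-B∖A : p + 2 ⊓ #δᵘ B∖A ≤ #δ B∖A
  flex-B∖A = cut-bound flex B∖A A∖B (proj₁ (proj₂ (proj₂ A⋈B))) (proj₁ A⋈B)
  flex-A∖C : p + 2 ⊓ #δᵘ A∖C ≤ #δ A∖C
  flex-A∖C = cut-bound flex A∖C A∩C (proj₁ A⋈C) (proj₁ (proj₂ A⋈C))
  flex-A∩C : p + 2 ⊓ #δᵘ A∩C ≤ #δ A∩C
  flex-A∩C = cut-bound flex A∩C A∖C (proj₁ (proj₂ A⋈C)) (proj₁ A⋈C)
  flex-C∖A : p + 2 ⊓ #δᵘ C∖A ≤ #δ C∖A
  flex-C∖A = cut-bound flex C∖A A∖C (proj₁ (proj₂ (proj₂ A⋈C))) (proj₁ A⋈C)
  flex-∁[A∪C] : p + 2 ⊓ #δᵘ ∁[A∪C] ≤ #δ ∁[A∪C]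
  flex-∁[A∪C] = cut-bound flex ∁[A∪C] A∖C (proj₂ (proj₂ (proj₂ A⋈C))) (proj₁ A⋈C)

  p<t+t : p < t + t
  p<t+t = pair-bound {t = t} odd flex-A∩B flex-B∖A cut-B (2≤2⊓u+2⊓v {#δᵘ A∩B} (≤-trans (proj₂ vB) δᵘB≤))
  p<c₀+c₀ : p < c₀ + c₀
  p<c₀+c₀ = pair-bound {t = c₀} odd flex-A∖C flex-∁[A∪C] cut-C₀
    (+-mono-≤ (1≤2⊓ (≤-trans 1≤acrossᵘ₀₀ acrossᵘ₀₀≤A∖C)) (1≤2⊓ (≤-trans 1≤acrossᵘ₀₀ acrossᵘ₀₀≤∁[A∪C])))
  p<c₁+c₁ : p < c₁ + c₁
  p<c₁+c₁ = pair-bound {t = c₁} odd flex-A∩C flex-C∖A cut-C₁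
    (+-mono-≤ (1≤2⊓ (≤-trans 1≤acrossᵘ₀₁ acrossᵘ₀₁≤A∩C)) (1≤2⊓ (≤-trans 1≤acrossᵘ₀₁ acrossᵘ₀₁≤C∖A)))

  3≤acrossᵘ : 3 ≤ acrossᵘ false false + acrossᵘ false true
  3≤acrossᵘ = ≤-trans (proj₂ vA) δᵘA≤

  1≤across₁₀×1≤across₁₁ : 1 ≤ across true false × 1 ≤ across true true
  1≤across₁₀×1≤across₁₁ with ≤-total c₀ c₁
  ... | inj₁ c₀≤c₁ = straddles-beside-smaller-cut odd (pair-excess {p} flex-A∖C flex-∁[A∪C] cut-C₀)
    acrossᵘ₀₀≤A∖C acrossᵘ₀₀≤∁[A∪C] 3≤acrossᵘ 1≤acrossᵘ₀₀ acrossᵘ₀₀≤across₀₀ acrossᵘ₀₁≤across₀₁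
    across₀ across₁ c₀+c₁≤ c₀≤c₁ t≤ p<t+t p<c₀+c₀
  ... | inj₂ c₁≤c₀ = swap (straddles-beside-smaller-cut odd (pair-excess {p} flex-A∩C flex-C∖A cut-C₁)
    acrossᵘ₀₁≤A∩C acrossᵘ₀₁≤C∖A (subst (3 ≤_) (+-comm (acrossᵘ false false) _) 3≤acrossᵘ) 1≤acrossᵘ₀₁
    acrossᵘ₀₁≤across₀₁ acrossᵘ₀₀≤across₀₀ across₁ across₀ (subst (_≤ p + 2) (+-comm c₀ c₁) c₀+c₁≤) c₁≤c₀
    (subst (t ≤_) (+-comm (across true false) _) t≤) p<t+t p<c₁+c₁)

  atom-flex : ∀ x y z → 1 ≤ across y z → p + 2 ⊓ #δᵘ (atom x y z) ≤ #δ (atom x y z)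
  atom-flex x y z 1≤across = flex-cut-bound flex ⟦ atom x y z ⟧ (inhabited x) outside
    where
    inhabited : ∀ x → Nonempty ⟦ atom x y z ⟧
    inhabited true  = proj₁ (between-nonempty (atom true y z) (atom false y z) 1≤across)
    inhabited false = proj₂ (between-nonempty (atom true y z) (atom false y z) 1≤across)
    outside : Nonempty (compl ⟦ atom x y z ⟧)
    outside = let v , v∈ = inhabited (not x) in v , atom-disjoint x y z (A v) (B v) (C v) v∈

  atoms : List Region
  atoms = atom true false false ∷ atom false false false ∷ atom true false true ∷ atom false false true
        ∷ atom true true false  ∷ atom false true false  ∷ atom true true true  ∷ atom false true true ∷ []

  atoms-cut : ∑ (map #δ atoms) ≤ 6 * (p + 2)
  atoms-cut = begin
    ∑ (map #δ atoms)
      ≤⟨ count-≤ (map boundary atoms) (map boundary (isA ∷ isA ∷ isB ∷ isB ∷ isC ∷ isC ∷ [])) ⟩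
    #δ isA + (#δ isA + (#δ isB + (#δ isB + (#δ isC + #δ isC))))
      ≡⟨ cong₂ _+_ ∣A∣ (cong₂ _+_ ∣A∣ (cong₂ _+_ ∣B∣ (cong₂ _+_ ∣B∣ (cong₂ _+_ ∣C∣ ∣C∣)))) ⟩
    (p + 2) + ((p + 2) + ((p + 2) + ((p + 2) + ((p + 2) + (p + 2)))))
      ≡⟨ solve (p ∷ []) ⟩
    6 * (p + 2) ∎
    where
    open ≤-Reasoning
    ∣A∣ : #δ isA ≡ p + 2
    ∣A∣ = proj₁ vA
    ∣B∣ : #δ isB ≡ p + 2
    ∣B∣ = proj₁ vB
    ∣C∣ : #δ isC ≡ p + 2
    ∣C∣ = proj₁ vC

  atoms-flex : 1 ≤ across false false → 1 ≤ across false true → 1 ≤ across true false → 1 ≤ across true true →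
    8 * p + ∑ (map (λ φ → 2 ⊓ #δᵘ φ) atoms) ≤ ∑ (map #δ atoms)
  atoms-flex ne₀₀ ne₀₁ ne₁₀ ne₁₁ = begin
    8 * p + ∑ (map (λ φ → 2 ⊓ #δᵘ φ) atoms)                         ≡⟨ cong (_+ ∑ (map (λ φ → 2 ⊓ #δᵘ φ) atoms)) 8p≡ ⟩
    ∑ (map (λ _ → p) atoms) + ∑ (map (λ φ → 2 ⊓ #δᵘ φ) atoms)        ≡⟨ ∑-map-+ (λ _ → p) (λ φ → 2 ⊓ #δᵘ φ) atoms ⟨
    ∑ (map (λ φ → p + 2 ⊓ #δᵘ φ) atoms)                             ≤⟨ ∑-mono {f = λ φ → p + 2 ⊓ #δᵘ φ} {g = #δ} atoms
      (atom-flex true false false ne₀₀ All.∷ atom-flex false false false ne₀₀ All.∷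
       atom-flex true false true  ne₀₁ All.∷ atom-flex false false true  ne₀₁ All.∷
       atom-flex true true  false ne₁₀ All.∷ atom-flex false true  false ne₁₀ All.∷
       atom-flex true true  true  ne₁₁ All.∷ atom-flex false true  true  ne₁₁ All.∷ All.[]) ⟩
    ∑ (map #δ atoms)                                                ∎
    where
    open ≤-Reasoning
    8p≡ : 8 * p ≡ p + (p + (p + (p + (p + (p + (p + p))))))
    8p≡ = solve (p ∷ [])

  B-atoms-unsafe : #δᵘ isB ≤ #δᵘ (atom true true false) + (#δᵘ (atom false true false) +
                              (#δᵘ (atom true true true) + #δᵘ (atom false true true)))
  B-atoms-unsafe = count-≤ (unsafeIn (boundary isB) ∷ [])
    (unsafeIn (boundary (atom true true false)) ∷ unsafeIn (boundary (atom false true false)) ∷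
     unsafeIn (boundary (atom true true true)) ∷ unsafeIn (boundary (atom false true true)) ∷ [])

  acrossᵘ≤atom : ∀ x z → acrossᵘ false z ≤ #δᵘ (atom x false z)
  acrossᵘ≤atom x@true  z@false = count-≤ (unsafeIn (between (atom true false z) (atom false false z)) ∷ [])
                                         (unsafeIn (boundary (atom x false z)) ∷ [])
  acrossᵘ≤atom x@false z@false = count-≤ (unsafeIn (between (atom true false z) (atom false false z)) ∷ [])
                                         (unsafeIn (boundary (atom x false z)) ∷ [])
  acrossᵘ≤atom x@true  z@true  = count-≤ (unsafeIn (between (atom true false z) (atom false false z)) ∷ [])
                                         (unsafeIn (boundary (atom x false z)) ∷ [])
  acrossᵘ≤atom x@false z@true  = count-≤ (unsafeIn (between (atom true false z) (atom false false z)) ∷ [])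
                                         (unsafeIn (boundary (atom x false z)) ∷ [])

  impossible : ⊥
  impossible = 8p+7≰6[p+2] 3≤p bonus (≤-trans (atoms-flex 1≤across₀₀ 1≤across₀₁ 1≤across₁₀ 1≤across₁₁) atoms-cut)
    where
    1≤across₀₀ : 1 ≤ across false false
    1≤across₀₀ = ≤-trans 1≤acrossᵘ₀₀ acrossᵘ₀₀≤across₀₀
    1≤across₀₁ : 1 ≤ across false true
    1≤across₀₁ = ≤-trans 1≤acrossᵘ₀₁ acrossᵘ₀₁≤across₀₁
    1≤across₁₀ : 1 ≤ across true false
    1≤across₁₀ = proj₁ 1≤across₁₀×1≤across₁₁
    1≤across₁₁ : 1 ≤ across true true
    1≤across₁₁ = proj₂ 1≤across₁₀×1≤across₁₁
    bonus : 7 ≤ ∑ (map (λ φ → 2 ⊓ #δᵘ φ) atoms)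
    bonus = 7≤b₁+b₂+b₃+b₄+r (3≤2⊓u+2⊓v 1≤acrossᵘ₀₀ 1≤acrossᵘ₀₁ 3≤acrossᵘ)
      (⊓-monoʳ-≤ 2 (acrossᵘ≤atom true false)) (⊓-monoʳ-≤ 2 (acrossᵘ≤atom false false))
      (⊓-monoʳ-≤ 2 (acrossᵘ≤atom true true)) (⊓-monoʳ-≤ 2 (acrossᵘ≤atom false true))
      (1≤2⊓-sum {#δᵘ (atom true true false)} {#δᵘ (atom false true false)}
                 {#δᵘ (atom true true true)} {#δᵘ (atom false true true)}
                 (≤-trans (s≤s z≤n) (≤-trans (proj₂ vB) B-atoms-unsafe)))

lemma5 : (p : ℕ) → 3 ≤ p → Odd p → (G : Graph) → FlexConnected G p →
    (A B : VSet G) → Violated G p A → Violated G p B → AmenablyCross G A B →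
    (C : VSet G) → Violated G p C → ¬ Cross G A C ⊎ AmenablyCross G A C
lemma5 p 3≤p odd G flex A B vA vB (A⋈B , safe-side) C vC with cross? {G} A C
... | no ¬A⋈C = inj₁ ¬A⋈C
... | yes A⋈C with noUnsafeEdge? {G} (Ebetween G (A ∩ C) (C ∖ A))
                | noUnsafeEdge? {G} (Ebetween G (A ∖ C) (compl (A ∪ C)))
...   | yes safe₁ | _         = inj₂ (A⋈C , inj₁ safe₁)
...   | no _      | yes safe₂ = inj₂ (A⋈C , inj₂ safe₂)
...   | no ¬safe₁ | no ¬safe₂ with safe-side
...     | inj₁ safe = ⊥-elim (NonAmenableCrossing.impossible odd 3≤p flex A B C vA vB vC
                                A⋈B A⋈C safe ¬safe₁ ¬safe₂)
...     | inj₂ safe = ⊥-elim (NonAmenableCrossing.impossible odd 3≤p flex A (compl B) C vA (violated-compl {G} B vB) vC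
                                (cross-compl {G} {A} {B} A⋈B) A⋈C (noUnsafeEdge-compl {G} {A} {B} safe) ¬safe₁ ¬safe₂)
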